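{- For $n\ge5$, the set of all covers of $p_n$ is $\{p_4,p_5,\ldots,p_n\}$.
   Context: Fibonacci words are defined by $f_0=0$, $f_1=1$, $f_n=f_{n-1}f_{n-2}$ for $n\ge2$, with $F_n=|f_n|$. For $n\ge2$, $p_n=f_n[1..F_n-2]$ denotes $f_n$ with its last two symbols removed. A cover of a string $x$ is a substring $u$ of $x$ such that $x$ can be constructed by overlapping and/or adjacent occurrences of $u$ (i.e., every position of $x$ lies in some occurrence of $u$ in $x$); $x$ is itself a cover of $x$. -}

module Defs where

open import Data.Nat using (ℕ; zero; suc; _∸_; _+_; _≤_; _<_)
open import Data.List using (List; []; _∷_; _++_; length; take; drop)
open import Data.Product using (Σ; ∃; _×_; _,_)
open import Relation.Binary.PropositionalEquality using (_≡_)

data Sym : Set where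
  s0 s1 : Sym

Word : Set
Word = List Sym

fib : ℕ → Word
fib zero = s0 ∷ []
fib (suc zero) = s1 ∷ []
fib (suc (suc n)) = fib (suc n) ++ fib n

-- p n = f n with its last two symbols removed (used for n ≥ 2)
p : ℕ → Word
p n = take (length (fib n) ∸ 2) (fib n)

_IsPrefixOf_ : Word → Word → Set
u IsPrefixOf w = Σ Word λ v → u ++ v ≡ w

OccursAt : Word → Word → ℕ → Set
OccursAt u x i = u IsPrefixOf drop i x

Substring : Word → Word → Set
Substring u x = Σ Word λ a → Σ Word λ b → a ++ u ++ b ≡ x

IsCover : Word → Word → Set
IsCover u x =
  Substring u x ×
  ((j : ℕ) → j < length x →
     Σ ℕ λ i → OccursAt u x i × i ≤ j × j < i + length u)

-- Write central n for p (2 + n). Besides its defining factorisation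
-- central (2 + n) = central (1 + n) · ending (1 + n) · central n, one has
-- central (2 + n) = fib (2 + n) · central (1 + n); so central (1 + n) is both a prefix and
-- an overlapping suffix of central (2 + n), hence covers it, and covers compose.
-- Conversely a cover is a border (a prefix that is also a suffix), and by induction the
-- borders of central n are exactly the central k with k ≤ n. A border u of
-- x = central (3 + N) strictly longer than y = central (2 + N) would make y · a · r = z · y
-- with a the first letter of ending (2 + N) and |z| < |fib (3 + N)|; then y = y′ · a · r for
-- a border y′ of y longer than central N, i.e. y′ = central (1 + N), which is followed in y
-- by the first letter of ending (1 + N) ≠ a. Finally ε and 1 do not cover central (2 + N).
module Submission where

open import Defs
open import Data.Nat
  using (ℕ; zero; suc; _+_; _∸_; _≤_; _<_; _≤′_; ≤′-refl; ≤′-step; z≤n; s≤s; s≤s⁻¹; _≤?_; _<?_)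
open import Data.Nat.Properties
open import Data.List using (List; []; _∷_; _++_; length; take; drop)
open import Data.List.Properties
  using (∷-injective; ∷-injectiveˡ; length-++; length-++-≤ˡ; ++-assoc; ++-identityʳ; ++-cancelˡ;
         take++drop≡id; length-drop; drop-drop)
open import Data.Product using (Σ; _×_; _,_; proj₁)
open import Data.Sum using (inj₁; inj₂)
open import Data.Empty using (⊥; ⊥-elim)
open import Relation.Nullary using (¬_; yes; no)
open import Relation.Binary.PropositionalEquality
  using (_≡_; _≢_; refl; sym; trans; cong; subst; subst₂; cong₂; module ≡-Reasoning)

private
  variable
    A : Set

++-splitˡ : ∀ (a b a′ b′ : List A) → a ++ b ≡ a′ ++ b′ → length a′ ≤ length a →
            Σ (List A) λ t → a ≡ a′ ++ t × b′ ≡ t ++ b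
++-splitˡ a       b []        b′ eq _ = a , refl , sym eq
++-splitˡ (x ∷ a) b (x′ ∷ a′) b′ eq (s≤s a′≤a) with ∷-injective eq
... | refl , eq′ with ++-splitˡ a b a′ b′ eq′ a′≤a
...   | t , a≡a′++t , b′≡t++b = t , cong (x ∷_) a≡a′++t , b′≡t++b

++-splitʳ : ∀ (a b a′ b′ : List A) → a ++ b ≡ a′ ++ b′ → length b ≤ length b′ →
            Σ (List A) λ t → a ≡ a′ ++ t × b′ ≡ t ++ b
++-splitʳ a b a′ b′ eq b≤b′ =
  ++-splitˡ a b a′ b′ eq (+-cancelʳ-≤ (length b) (length a′) (length a) (begin
  length a′ + length b   ≤⟨ +-monoʳ-≤ (length a′) b≤b′ ⟩
  length a′ + length b′  ≡⟨ sym (length-++ a′) ⟩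
  length (a′ ++ b′)      ≡⟨ cong length (sym eq) ⟩
  length (a ++ b)        ≡⟨ length-++ a ⟩
  length a + length b    ∎))
  where open ≤-Reasoning

drop-++ˡ : ∀ n (xs ys : List A) → n ≤ length xs → drop n (xs ++ ys) ≡ drop n xs ++ ys
drop-++ˡ zero    xs       ys _         = refl
drop-++ˡ (suc n) (x ∷ xs) ys (s≤s n≤) = drop-++ˡ n xs ys n≤

take-length-++ : ∀ (xs ys : List A) → take (length xs) (xs ++ ys) ≡ xs
take-length-++ []       ys = refl
take-length-++ (x ∷ xs) ys = cong (x ∷_) (take-length-++ xs ys)

drop-length-++ : ∀ (xs ys : List A) → drop (length xs) (xs ++ ys) ≡ ys
drop-length-++ []       ys = refl
drop-length-++ (x ∷ xs) ys = drop-length-++ xs ys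

_IsSuffixOf_ : Word → Word → Set
u IsSuffixOf w = Σ Word λ v → v ++ u ≡ w

_IsBorderOf_ : Word → Word → Set
u IsBorderOf x = u IsPrefixOf x × u IsSuffixOf x

prefix-of-length : ∀ {u x} → u IsPrefixOf x → length x ≤ length u → u ≡ x
prefix-of-length {u} ([]    , u++[]≡x) _   = trans (sym (++-identityʳ u)) u++[]≡x
prefix-of-length {u} (_ ∷ _ , refl)    x≤u =
  ⊥-elim (m+1+n≰m (length u) (subst (_≤ length u) (length-++ u) x≤u))

shorter-border : ∀ {u y x} → u IsBorderOf x → y IsBorderOf x → length u ≤ length y →
                 u IsBorderOf y
shorter-border ((v , u++v≡x) , (w , w++u≡x)) ((s , y++s≡x) , (w′ , w′++y≡x)) u≤y
  with ++-splitˡ _ s _ v (trans y++s≡x (sym u++v≡x)) u≤y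
     | ++-splitʳ w _ w′ _ (trans w++u≡x (sym w′++y≡x)) u≤y
... | t , y≡u++t , _ | t′ , _ , y≡t′++u = (t , sym y≡u++t) , (t′ , sym y≡t′++u)

CoveredAt : Word → Word → ℕ → Set
CoveredAt u x j = Σ ℕ λ i → OccursAt u x i × i ≤ j × j < i + length u

occursAt-trans : ∀ {u v x i j} → j ≤ length v → OccursAt u v j → OccursAt v x i →
                 OccursAt u x (i + j)
occursAt-trans {u} {v} {x} {i} {j} j≤v (r′ , u++r′≡) (r , v++r≡) = r′ ++ r , (begin
  u ++ r′ ++ r        ≡⟨ sym (++-assoc u r′ r) ⟩
  (u ++ r′) ++ r      ≡⟨ cong (_++ r) u++r′≡ ⟩
  drop j v ++ r       ≡⟨ sym (drop-++ˡ j v r j≤v) ⟩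
  drop j (v ++ r)     ≡⟨ cong (drop j) v++r≡ ⟩
  drop j (drop i x)   ≡⟨ drop-drop i j x ⟩
  drop (i + j) x      ∎)
  where open ≡-Reasoning

substring-trans : ∀ {u v x} → Substring u v → Substring v x → Substring u x
substring-trans {u} {v} {x} (a , b , a++u++b≡v) (a′ , b′ , a′++v++b′≡x) = a′ ++ a , b ++ b′ , (begin
  (a′ ++ a) ++ u ++ b ++ b′    ≡⟨ ++-assoc a′ a _ ⟩
  a′ ++ a ++ u ++ b ++ b′      ≡⟨ cong (λ t → a′ ++ a ++ t) (sym (++-assoc u b b′)) ⟩
  a′ ++ a ++ (u ++ b) ++ b′    ≡⟨ cong (a′ ++_) (sym (++-assoc a (u ++ b) b′)) ⟩
  a′ ++ (a ++ u ++ b) ++ b′    ≡⟨ cong (λ t → a′ ++ t ++ b′) a++u++b≡v ⟩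
  a′ ++ v ++ b′                ≡⟨ a′++v++b′≡x ⟩
  x                            ∎)
  where open ≡-Reasoning

cover-trans : ∀ {u v x} → IsCover u v → IsCover v x → IsCover u x
cover-trans {u} {v} {x} (u⊑v , u-covers) (v⊑x , v-covers) = substring-trans u⊑v v⊑x , covered
  where
  covered : ∀ j → j < length x → CoveredAt u x j
  covered j j<x with v-covers j j<x
  ... | i , v-at-i , i≤j , j<i+v = shift (u-covers (j ∸ i) j∸i<v)
    where
    i+[j∸i]≡j : i + (j ∸ i) ≡ j
    i+[j∸i]≡j = m+[n∸m]≡n i≤j
    j∸i<v : j ∸ i < length v
    j∸i<v = +-cancelˡ-< i _ _ (subst (_< i + length v) (sym i+[j∸i]≡j) j<i+v)
    shift : CoveredAt u v (j ∸ i) → CoveredAt u x j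
    shift (k , u-at-k , k≤ , <k+u) =
      i + k ,
      occursAt-trans {x = x} {i} (≤-trans k≤ (<⇒≤ j∸i<v)) u-at-k v-at-i ,
      subst (i + k ≤_) i+[j∸i]≡j (+-monoʳ-≤ i k≤) ,
      subst₂ _<_ i+[j∸i]≡j (sym (+-assoc i k (length u))) (+-monoʳ-< i <k+u)

overlapping-border-covers : ∀ {u v w x} → u ++ v ≡ x → w ++ u ≡ x → length w ≤ length u →
                            IsCover u x
overlapping-border-covers {u} {v} {w} {x} u++v≡x w++u≡x w≤u = ([] , v , u++v≡x) , covered
  where
  covered : ∀ j → j < length x → CoveredAt u x j
  covered j j<x with j <? length u
  ... | yes j<u = 0 , (v , u++v≡x) , z≤n , j<u
  ... | no  j≮u =
    length w ,
    ([] , trans (++-identityʳ u) (sym (trans (cong (drop (length w)) (sym w++u≡x))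
                                             (drop-length-++ w u)))) ,
    ≤-trans w≤u (≮⇒≥ j≮u) ,
    subst (j <_) (trans (cong length (sym w++u≡x)) (length-++ w)) j<x

cover-refl : ∀ x → IsCover x x
cover-refl x = overlapping-border-covers (++-identityʳ x) refl z≤n

occursAt-end : ∀ {u x i} → OccursAt u x i → length x ≤ i + length u → u IsSuffixOf x
occursAt-end {u} {x} {i} ([] , u++[]≡) _ =
  take i x , trans (cong (take i x ++_) (trans (sym (++-identityʳ u)) u++[]≡)) (take++drop≡id i x)
occursAt-end {u} {x} {i} (b ∷ v , u++bv≡) x≤i+u = ⊥-elim (m+1+n≰m (length u) (begin
  length u + suc (length v)   ≡⟨ sym (length-++ u) ⟩
  length (u ++ b ∷ v)         ≡⟨ cong length u++bv≡ ⟩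
  length (drop i x)           ≡⟨ length-drop i x ⟩
  length x ∸ i                ≤⟨ ∸-monoˡ-≤ i x≤i+u ⟩
  i + length u ∸ i            ≡⟨ m+n∸m≡n i (length u) ⟩
  length u                    ∎))
  where open ≤-Reasoning

cover⇒border : ∀ {u a x} → IsCover u (a ∷ x) → u IsBorderOf (a ∷ x)
cover⇒border {x = x} (_ , covered) with covered 0 (s≤s z≤n) | covered (length x) ≤-refl
... | _ , u-at-0 , z≤n , _ | _ , u-at-i , _ , x<i+u = u-at-0 , occursAt-end u-at-i x<i+u

¬[]-covers : ∀ {a x} → ¬ IsCover [] (a ∷ x)
¬[]-covers (_ , covered) with covered 0 (s≤s z≤n)
... | _ , _ , z≤n , ()

¬1-covers-10 : ∀ r → ¬ IsCover (s1 ∷ []) (s1 ∷ s0 ∷ r)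
¬1-covers-10 r (_ , covered) with covered 1 (s≤s (s≤s z≤n))
... | 0           , _         , _       , s≤s ()
... | 1           , (_ , ()) , _       , _
... | suc (suc _) , _         , s≤s () , _

penult : ℕ → Sym
penult zero          = s1
penult (suc zero)    = s0
penult (suc (suc n)) = penult n

penult-suc : ∀ n → penult (suc n) ≢ penult n
penult-suc zero          ()
penult-suc (suc zero)    ()
penult-suc (suc (suc n)) = penult-suc n

ending : ℕ → Word
ending n = penult n ∷ penult (suc n) ∷ []

central : ℕ → Word
central zero          = []
central (suc zero)    = s1 ∷ []
central (suc (suc n)) = central (suc n) ++ ending (suc n) ++ central n

fib≡central++ending : ∀ n → fib (2 + n) ≡ central n ++ ending n
fib≡central++ending zero          = refl
fib≡central++ending (suc zero)    = refl
fib≡central++ending (suc (suc n)) = begin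
  fib (3 + n) ++ fib (2 + n)
    ≡⟨ cong₂ _++_ (fib≡central++ending (suc n)) (fib≡central++ending n) ⟩
  (central (1 + n) ++ ending (1 + n)) ++ central n ++ ending n
    ≡⟨ ++-assoc (central (1 + n)) (ending (1 + n)) _ ⟩
  central (1 + n) ++ ending (1 + n) ++ central n ++ ending n
    ≡⟨ cong (central (1 + n) ++_) (sym (++-assoc (ending (1 + n)) (central n) (ending n))) ⟩
  central (1 + n) ++ (ending (1 + n) ++ central n) ++ ending n
    ≡⟨ sym (++-assoc (central (1 + n)) _ (ending n)) ⟩
  central (2 + n) ++ ending n
    ∎
  where open ≡-Reasoning

p≡central : ∀ n → p (2 + n) ≡ central n
p≡central n = begin
  take (length (fib (2 + n)) ∸ 2) (fib (2 + n))
    ≡⟨ cong (λ w → take (length w ∸ 2) w) (fib≡central++ending n) ⟩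
  take (length (central n ++ ending n) ∸ 2) (central n ++ ending n)
    ≡⟨ cong (λ m → take (m ∸ 2) (central n ++ ending n)) (length-++ (central n)) ⟩
  take (length (central n) + 2 ∸ 2) (central n ++ ending n)
    ≡⟨ cong (λ m → take m (central n ++ ending n)) (m+n∸n≡m (length (central n)) 2) ⟩
  take (length (central n)) (central n ++ ending n)
    ≡⟨ take-length-++ (central n) (ending n) ⟩
  central n
    ∎
  where open ≡-Reasoning

central-unfold : ∀ n → central (2 + n) ≡ fib (3 + n) ++ central n
central-unfold n = begin
  central (1 + n) ++ ending (1 + n) ++ central n
    ≡⟨ sym (++-assoc (central (1 + n)) _ _) ⟩
  (central (1 + n) ++ ending (1 + n)) ++ central n
    ≡⟨ cong (_++ central n) (sym (fib≡central++ending (1 + n))) ⟩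
  fib (3 + n) ++ central n
    ∎
  where open ≡-Reasoning

central-unfold′ : ∀ n → central (2 + n) ≡ fib (2 + n) ++ central (1 + n)
central-unfold′ zero    = refl
central-unfold′ (suc n) = begin
  central (3 + n)
    ≡⟨ central-unfold (1 + n) ⟩
  (fib (3 + n) ++ fib (2 + n)) ++ central (1 + n)
    ≡⟨ ++-assoc (fib (3 + n)) _ _ ⟩
  fib (3 + n) ++ fib (2 + n) ++ central (1 + n)
    ≡⟨ cong (fib (3 + n) ++_) (sym (central-unfold′ n)) ⟩
  fib (3 + n) ++ central (2 + n)
    ∎
  where open ≡-Reasoning

length-central : ∀ n → length (central (2 + n)) ≡ length (fib (3 + n)) + length (central n)
length-central n = trans (cong length (central-unfold n)) (length-++ (fib (3 + n)))

length-central-mono : ∀ {k n} → k ≤ n → length (central k) ≤ length (central n)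
length-central-mono k≤n = go (≤⇒≤′ k≤n)
  where
  step : ∀ n → length (central n) ≤ length (central (suc n))
  step zero    = z≤n
  step (suc n) = length-++-≤ˡ (central (suc n))
  go : ∀ {k n} → k ≤′ n → length (central k) ≤ length (central n)
  go ≤′-refl          = ≤-refl
  go (≤′-step {n} k≤n) = ≤-trans (go k≤n) (step n)

central-starts-10 : ∀ n → Σ Word λ r → central (2 + n) ≡ s1 ∷ s0 ∷ r
central-starts-10 zero = s1 ∷ [] , refl
central-starts-10 (suc n) with central-starts-10 n
... | r , y≡10r = r ++ rest , cong (_++ rest) y≡10r
  where rest = ending (2 + n) ++ central (1 + n)

central-covers-next : ∀ n → IsCover (central (2 + n)) (central (3 + n))
central-covers-next n =
  overlapping-border-covers {u = central (2 + n)} {w = fib (3 + n)}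
    refl (sym (central-unfold′ (1 + n))) (begin
  length (fib (3 + n))                          ≤⟨ m≤m+n _ _ ⟩
  length (fib (3 + n)) + length (central n)     ≡⟨ sym (length-central n) ⟩
  length (central (2 + n))                      ∎)
  where open ≤-Reasoning

central-covers : ∀ {k n} → 2 ≤ k → k ≤ n → IsCover (central k) (central n)
central-covers 2≤k k≤n = go 2≤k (≤⇒≤′ k≤n)
  where
  go : ∀ {k n} → 2 ≤ k → k ≤′ n → IsCover (central k) (central n)
  go _   ≤′-refl = cover-refl _
  go 2≤k (≤′-step k≤n) with ≤-trans 2≤k (≤′⇒≤ k≤n)
  ... | s≤s (s≤s {n = m} _) = cover-trans (go 2≤k k≤n) (central-covers-next m)

central-border-next : ∀ n → central (1 + n) IsBorderOf central (2 + n)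
central-border-next n =
  (ending (1 + n) ++ central n , refl) , (fib (2 + n) , sym (central-unfold′ n))

BordersAreCentral : ℕ → Set
BordersAreCentral n = ∀ u → u IsBorderOf central n → Σ ℕ λ k → k ≤ n × u ≡ central k

central-next-letter : ∀ N K r → K ≤ 2 + N → central K ++ penult N ∷ r ≡ central (2 + N) → K ≤ N
central-next-letter N K r K≤2+N eq with K ≤? N
... | yes K≤N = K≤N
... | no  K≰N with m≤n⇒m<n∨m≡n K≤2+N
...   | inj₂ refl with ++-cancelˡ (central (2 + N)) (penult N ∷ r) [] (trans eq (sym (++-identityʳ _)))
...     | ()
central-next-letter N K r K≤2+N eq | no K≰N | inj₁ K<2+N with ≤-antisym (s≤s⁻¹ K<2+N) (≰⇒> K≰N)
... | refl = ⊥-elim (penult-suc N (sym (∷-injectiveˡ (++-cancelˡ (central (1 + N)) _ _ eq))))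

no-short-period : ∀ N → BordersAreCentral (2 + N) → ∀ z r →
                  central (2 + N) ++ penult N ∷ r ≡ z ++ central (2 + N) →
                  length z < length (fib (3 + N)) → ⊥
no-short-period N borders z r y·ar≡z·y z<f
  with ++-splitˡ (central (2 + N)) (penult N ∷ r) z (central (2 + N)) y·ar≡z·y
         (≤-trans (<⇒≤ z<f) (≤-trans (m≤m+n _ _) (≤-reflexive (sym (length-central N)))))
... | y′ , y≡z++y′ , y≡y′++ar with borders y′ ((penult N ∷ r , sym y≡y′++ar) , (z , sym y≡z++y′))
... | K , K≤2+N , refl = <-irrefl refl (begin-strict
  length (central (2 + N))                   ≡⟨ cong length y≡z++y′ ⟩
  length (z ++ central K)                    ≡⟨ length-++ z ⟩
  length z + length (central K)              <⟨ +-mono-<-≤ z<f (length-central-mono K≤N) ⟩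
  length (fib (3 + N)) + length (central N)  ≡⟨ sym (length-central N) ⟩
  length (central (2 + N))                   ∎)
  where
  open ≤-Reasoning
  K≤N : K ≤ N
  K≤N = central-next-letter N K r K≤2+N (sym y≡y′++ar)

no-border-between : ∀ N → BordersAreCentral (2 + N) → ∀ u → u IsBorderOf central (3 + N) →
                    length (central (2 + N)) < length u → length u < length (central (3 + N)) → ⊥
no-border-between N borders u ((v , u++v≡x) , (w , w++u≡x)) y<u u<x
  with ++-splitˡ u v (central (2 + N)) (ending (2 + N) ++ central (1 + N)) u++v≡x (<⇒≤ y<u)
     | ++-splitʳ (fib (3 + N)) (central (2 + N)) w u
         (trans (sym (central-unfold′ (1 + N))) (sym w++u≡x)) (<⇒≤ y<u)
... | [] , u≡y++[] , _ | _ = <-irrefl (sym (cong length (trans u≡y++[] (++-identityʳ _)))) y<u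
... | a ∷ r , u≡y++ar , s≡ar++v | z , _ , u≡z++y with ∷-injectiveˡ s≡ar++v
... | refl = no-short-period N borders z r (trans (sym u≡y++ar) u≡z++y)
  (+-cancelʳ-< (length (central (2 + N))) (length z) (length (fib (3 + N))) (begin-strict
    length z + length (central (2 + N))            ≡⟨ sym (length-++ z) ⟩
    length (z ++ central (2 + N))                  ≡⟨ cong length (sym u≡z++y) ⟩
    length u                                       <⟨ u<x ⟩
    length (central (3 + N))                       ≡⟨ cong length (central-unfold′ (1 + N)) ⟩
    length (fib (3 + N) ++ central (2 + N))        ≡⟨ length-++ (fib (3 + N)) ⟩
    length (fib (3 + N)) + length (central (2 + N)) ∎))
  where open ≤-Reasoning

borders-central-step : ∀ N → BordersAreCentral (2 + N) → BordersAreCentral (3 + N)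
borders-central-step N borders u border with length u ≤? length (central (2 + N))
... | yes u≤y with borders u (shorter-border border (central-border-next (1 + N)) u≤y)
...   | k , k≤2+N , u≡central-k = k , m≤n⇒m≤1+n k≤2+N , u≡central-k
borders-central-step N borders u border | no u≰y with length u <? length (central (3 + N))
... | yes u<x = ⊥-elim (no-border-between N borders u border (≰⇒> u≰y) u<x)
... | no  u≮x = 3 + N , ≤-refl , prefix-of-length (proj₁ border) (≮⇒≥ u≮x)

borders-central : ∀ n → BordersAreCentral n
borders-central 0 []      _             = 0 , z≤n , refl
borders-central 0 (_ ∷ _) ((_ , ()) , _)
borders-central 1 []            _             = 0 , z≤n , refl
borders-central 1 (s1 ∷ [])     _             = 1 , ≤-refl , refl
borders-central 1 (s0 ∷ _)      ((_ , ()) , _)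
borders-central 1 (s1 ∷ _ ∷ _) ((_ , ()) , _)
borders-central 2 []                       _             = 0 , z≤n , refl
borders-central 2 (s1 ∷ [])                _             = 1 , s≤s z≤n , refl
borders-central 2 (s1 ∷ s0 ∷ s1 ∷ [])      _             = 2 , ≤-refl , refl
borders-central 2 (s0 ∷ _)                 ((_ , ()) , _)
borders-central 2 (s1 ∷ s1 ∷ _)            ((_ , ()) , _)
borders-central 2 (s1 ∷ s0 ∷ s0 ∷ _)       ((_ , ()) , _)
borders-central 2 (s1 ∷ s0 ∷ s1 ∷ _ ∷ _)   ((_ , ()) , _)
borders-central 2 (s1 ∷ s0 ∷ []) (_ , ([]                    , ()))
borders-central 2 (s1 ∷ s0 ∷ []) (_ , (_ ∷ []                , ()))
borders-central 2 (s1 ∷ s0 ∷ []) (_ , (_ ∷ _ ∷ []            , ()))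
borders-central 2 (s1 ∷ s0 ∷ []) (_ , (_ ∷ _ ∷ _ ∷ []        , ()))
borders-central 2 (s1 ∷ s0 ∷ []) (_ , (_ ∷ _ ∷ _ ∷ _ ∷ _    , ()))
borders-central (suc (suc (suc N))) = borders-central-step N (borders-central (suc (suc N)))

covers-central : ∀ N u → IsCover u (central (2 + N)) →
                 Σ ℕ λ k → 2 ≤ k × k ≤ 2 + N × u ≡ central k
covers-central N u cover with central-starts-10 N
... | r , y≡10r with subst (IsCover u) y≡10r cover
... | cover′ with borders-central (2 + N) u (subst (u IsBorderOf_) (sym y≡10r) (cover⇒border cover′))
... | 0           , _   , refl = ⊥-elim (¬[]-covers cover′)
... | 1           , _   , refl = ⊥-elim (¬1-covers-10 r cover′)
... | suc (suc k) , k≤  , u≡  = suc (suc k) , s≤s (s≤s z≤n) , k≤ , u≡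

lemma14 : (n : ℕ) → 5 ≤ n → (u : Word) →
    (IsCover u (p n) → Σ ℕ λ k → 4 ≤ k × k ≤ n × u ≡ p k) ×
    ((Σ ℕ λ k → 4 ≤ k × k ≤ n × u ≡ p k) → IsCover u (p n))
lemma14 (suc (suc (suc (suc N)))) (s≤s (s≤s (s≤s (s≤s _)))) u = only-if , if
  where
  only-if : IsCover u (p (4 + N)) → Σ ℕ λ k → 4 ≤ k × k ≤ 4 + N × u ≡ p k
  only-if cover with covers-central N u (subst (IsCover u) (p≡central (2 + N)) cover)
  ... | k , 2≤k , k≤2+N , u≡central-k =
    2 + k , s≤s (s≤s 2≤k) , s≤s (s≤s k≤2+N) , trans u≡central-k (sym (p≡central k))
  if : (Σ ℕ λ k → 4 ≤ k × k ≤ 4 + N × u ≡ p k) → IsCover u (p (4 + N))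
  if (suc (suc k) , s≤s (s≤s 2≤k) , s≤s (s≤s k≤2+N) , refl) =
    subst₂ IsCover (sym (p≡central k)) (sym (p≡central (2 + N))) (central-covers 2≤k k≤2+N)
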